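{- Let $r \in \mathbb{Z}_{>0} \setminus \{1,2,4\}$. Let $P$ be a Fano polygon with singularity content \[ \mathrm{SC}(P) = \left( 0, \left\{ \tfrac{1}{r}(1,s_{1}), \tfrac{1}{r}(1,s_{2}), \ldots, \tfrac{1}{r}(1,s_{k}) \right\} \right), \] where $1 \le s_i < r$ and $\gcd(r,s_i)=1$ for each $i$. Then $k \in \{3,4,5,6\}$ and the vertex set of $P$ is unimodular equivalent (i.e. equal up to a $\mathrm{GL}_2(\mathbb{Z})$-transformation) to one of the following, for some integer $s$: \begin{itemize} \item $\{ (0,1), (-r,s-1), (r,-s) \}$, where $\gcd (r,s) = \gcd (r,s-1) =1$; \item $\{ (0,1), (-r,s), (0,-1), (r,-s) \}$, where $\gcd (r,s) =1$; \item $\{ (0,1), (-r,s+1), (0,-1), (r,-s) \}$, where $\gcd (r,s) = \gcd (r,s+1) =1$; \item $\{ (0,1), (-r,s), (r,-s-1), (r,-s) \}$, where $\gcd (r,s) = \gcd (r,s+1) =1$; \item $\{ (0,1), (-r,s), (-r,s-1), (r,-s) \}$, where $\gcd (r,s) = \gcd (r,s-1) =1$; \item $\{ (0,1), (-r,s+1), (-r,s), (0,-1), (r,-s) \}$, where $\gcd (r,s) = \gcd (r,s+1) =1$; \item $\{ (0,1), (-r,s), (-r,s-1), (0,-1), (r,-s) \}$, where $\gcd (r,s) = \gcd(r,s-1) =1$; \item $\{ (0,1), (-r,s+1), (-r,s), (r,-s-1), (r,-s) \}$, where $\gcd (r,s) = \gcd (r,s+1) =1$; \item $\{ (0,1), (-r,s+1),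 (-r,s), (0,-1), (r,-s-1), (r,-s) \}$, where $\gcd (r,s) = \gcd (r,s+1) =1$. \end{itemize}
   Context: Work in the lattice $N=\mathbb{Z}^2$. A Fano polygon is a convex lattice polygon $P\subset\mathbb{R}^2$ containing the origin in its interior and whose vertices are primitive lattice points. For a two-dimensional cone $C$ with primitive ray generators $\rho_1,\rho_2$, let $E$ be the segment $[\rho_1,\rho_2]$; its lattice length is $\ell(C)=|E\cap \mathbb{Z}^2|-1$ and its lattice height $h(C)$ is the lattice distance from the origin to the line through $E$ (i.e. $|\langle u,n_E\rangle|$ for $u\in E$, $n_E$ the primitive inward normal in the dual lattice). Every such cone is $\mathrm{GL}_2(\mathbb{Z})$-equivalent to the cone spanned by $(0,1)$ and $(r,-s)$ with $r>0$, $0\le s<r$, $\gcd(r,s)=1$; the cone is then said to represent the cyclic quotient singularity $\frac1r(1,s)$, and two cones represent isomorphic singularities iff they are $\mathrm{GL}_2(\mathbb{Z})$-equivalent ($\frac1r(1,s)\cong\frac1r(1,s')$ iff $s'=s$ or $ss'\equiv1 \pmod r$). The cone is a T-cone (T-singularity) if $h(C)\mid \ell(C)$ and an R-cone (R-singularity) if $\ell(C)<h(C)$. If $\ell(C)=nh(C)+\rho$ with $n\ge 0$ and $0\le\rho<h(C)$, then $C$ subdivides into $n$ T-cones of length $h(C)$ and, when $\rho>0$, one R-cone of length $\rho$, whose singularity is the residual singularity $\mathrm{res}(C)$; the singularity content of $C$ is $(n,\mathrm{res}(C))$. For a Fano polygon $P$ with edges $E_1,\dots,E_m$ labelled clockwise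 and $C_i$ the cone over $E_i$ with singularity content $(n_i,\mathrm{res}(C_i))$, the singularity content of $P$ is $\mathrm{SC}(P)=(\sum_i n_i,\mathcal{B})$, where the basket $\mathcal{B}$ is the cyclically ordered list of the residual singularities $\mathrm{res}(C_i)$. -}

module Defs where

open import Data.Nat as ℕ using (ℕ; zero; suc)
import Data.Nat.DivMod as ℕD
open import Data.Nat.GCD using (gcd)
open import Data.Integer as ℤ using (ℤ; +_; ∣_∣; _-_; -_)
open import Data.Product using (Σ; _×_; _,_; proj₁; proj₂)
open import Data.Sum using (_⊎_)
open import Data.Maybe using (Maybe; just; nothing)
open import Data.List using (List; length; []; _∷_; _++_; [_]; zip; map; mapMaybe)
open import Data.Nat.ListAction using (sum)
open import Data.List.Relation.Unary.All using (All)
open import Data.List.Relation.Unary.Unique.Propositional using (Unique)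
open import Data.List.Membership.Propositional using (_∈_)
open import Relation.Binary.PropositionalEquality using (_≡_)
open import Relation.Nullary using (¬_)

Pt : Set
Pt = ℤ × ℤ

det : Pt → Pt → ℤ
det (a , b) (c , d) = a ℤ.* d ℤ.- b ℤ.* c

_−ₚ_ : Pt → Pt → Pt
(a , b) −ₚ (c , d) = (a ℤ.- c , b ℤ.- d)

_·ₚ_ : ℤ → Pt → Pt
k ·ₚ (a , b) = (k ℤ.* a , k ℤ.* b)

_+ₚ_ : Pt → Pt → Pt
(a , b) +ₚ (c , d) = (a ℤ.+ c , b ℤ.+ d)

Primitive : Pt → Set
Primitive (a , b) = gcd ∣ a ∣ ∣ b ∣ ≡ 1

record GL2 : Set where
  field
    a₁₁ a₁₂ a₂₁ a₂₂ : ℤ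
    unimodular : (a₁₁ ℤ.* a₂₂ ℤ.- a₁₂ ℤ.* a₂₁ ≡ ℤ.1ℤ) ⊎ (a₁₁ ℤ.* a₂₂ ℤ.- a₁₂ ℤ.* a₂₁ ≡ ℤ.-1ℤ)

act : GL2 → Pt → Pt
act A (x , y) = (a₁₁ ℤ.* x ℤ.+ a₁₂ ℤ.* y , a₂₁ ℤ.* x ℤ.+ a₂₂ ℤ.* y)
  where open GL2 A

-- Polygons, given by their vertex list in clockwise order.
-- Edges are the consecutive pairs (v_i , v_{i+1}), cyclically.

rotate : List Pt → List Pt
rotate []       = []
rotate (x ∷ xs) = xs ++ [ x ]

edges : List Pt → List (Pt × Pt)
edges vs = zip vs (rotate vs)

-- Fano polygon: at least 3 distinct primitive vertices listed clockwise,
-- strictly convex (every other vertex lies strictly on the interior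
-- (right-hand) side of every edge line), and the origin lies strictly on the
-- interior side of every edge line (i.e. in the interior of P).
record Fano (vs : List Pt) : Set where
  field
    atLeast3   : 3 ℕ.≤ length vs
    distinct   : Unique vs
    primVerts  : All Primitive vs
    convex     : All (λ e → ∀ p → p ∈ vs → ¬ (p ≡ proj₁ e) → ¬ (p ≡ proj₂ e) →
                        det (proj₂ e −ₚ proj₁ e) (p −ₚ proj₁ e) ℤ.< ℤ.0ℤ) (edges vs)
    originIn   : All (λ e → det (proj₁ e) (proj₂ e) ℤ.< ℤ.0ℤ) (edges vs)

-- Cones and singularity content.  A cone is given by two nonzero lattice
-- points spanning its rays (for cones over edges: the primitive vertices).

Cone : Set
Cone = Pt × Pt

-- total division / remainder on ℕ (value 0 for divisor 0; never used there)
_div_ : ℕ → ℕ → ℕ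
m div zero  = 0
m div suc n = m ℕD./ suc n

_mod_ : ℕ → ℕ → ℕ
m mod zero  = m
m mod suc n = m ℕD.% suc n

ℓ : Cone → ℕ
ℓ (u , v) = gcd ∣ proj₁ (v −ₚ u) ∣ ∣ proj₂ (v −ₚ u) ∣

h : Cone → ℕ
h (u , v) = ∣ det u v ∣ div ℓ (u , v)

nT : Cone → ℕ
nT C = ℓ C div h C

ρ : Cone → ℕ
ρ C = ℓ C mod h C

-- The residual R-cone: after n T-cones of length h placed starting at ρ₁,
-- the remaining cone is spanned by the point ρ₁ + n h (ρ₂-ρ₁)/ℓ and ρ₂;
-- we use the positive multiple ℓ·(that point) = (ℓ - n h) ρ₁ + n h ρ₂,
-- which spans the same ray.
residual : Cone → Maybe Cone
residual C@(u , v) with ρ C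
... | zero  = nothing
... | suc _ = just (((+ (ℓ C ℕ.∸ nT C ℕ.* h C)) ·ₚ u) +ₚ ((+ (nT C ℕ.* h C)) ·ₚ v) , v)

Represents : Cone → ℕ → ℕ → Set
Represents (u , v) r s =
  Σ GL2 λ A → Σ ℕ λ a → Σ ℕ λ b →
    ((act A u ≡ (+ suc a) ·ₚ e₁) × (act A v ≡ (+ suc b) ·ₚ e₂))
    ⊎ ((act A u ≡ (+ suc a) ·ₚ e₂) × (act A v ≡ (+ suc b) ·ₚ e₁))
  where
    e₁ e₂ : Pt
    e₁ = (ℤ.0ℤ , ℤ.1ℤ)
    e₂ = (+ r , - (+ s))

SC : List Pt → ℕ × List Cone
SC vs = (sum (map nT (edges vs)) , mapMaybe residual (edges vs))

Cop : ℕ → ℤ → Set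
Cop r t = gcd r ∣ t ∣ ≡ 1

SameSet : List Pt → List Pt → Set
SameSet xs ys = (∀ x → x ∈ xs → x ∈ ys) × (∀ x → x ∈ ys → x ∈ xs)

data NormalForm (r : ℕ) (s : ℤ) (V : List Pt) : Set where
  nf1 : Cop r s → Cop r (s - ℤ.1ℤ) →
        SameSet V ((ℤ.0ℤ , ℤ.1ℤ) ∷ (- + r , s - ℤ.1ℤ) ∷ (+ r , - s) ∷ []) → NormalForm r s V
  nf2 : Cop r s →
        SameSet V ((ℤ.0ℤ , ℤ.1ℤ) ∷ (- + r , s) ∷ (ℤ.0ℤ , ℤ.-1ℤ) ∷ (+ r , - s) ∷ []) → NormalForm r s V
  nf3 : Cop r s → Cop r (s ℤ.+ ℤ.1ℤ) →
        SameSet V ((ℤ.0ℤ , ℤ.1ℤ) ∷ (- + r , s ℤ.+ ℤ.1ℤ) ∷ (ℤ.0ℤ , ℤ.-1ℤ) ∷ (+ r , - s) ∷ []) → NormalForm r s V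
  nf4 : Cop r s → Cop r (s ℤ.+ ℤ.1ℤ) →
        SameSet V ((ℤ.0ℤ , ℤ.1ℤ) ∷ (- + r , s) ∷ (+ r , - s - ℤ.1ℤ) ∷ (+ r , - s) ∷ []) → NormalForm r s V
  nf5 : Cop r s → Cop r (s - ℤ.1ℤ) →
        SameSet V ((ℤ.0ℤ , ℤ.1ℤ) ∷ (- + r , s) ∷ (- + r , s - ℤ.1ℤ) ∷ (+ r , - s) ∷ []) → NormalForm r s V
  nf6 : Cop r s → Cop r (s ℤ.+ ℤ.1ℤ) →
        SameSet V ((ℤ.0ℤ , ℤ.1ℤ) ∷ (- + r , s ℤ.+ ℤ.1ℤ) ∷ (- + r , s) ∷ (ℤ.0ℤ , ℤ.-1ℤ) ∷ (+ r , - s) ∷ []) → NormalForm r s V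
  nf7 : Cop r s → Cop r (s - ℤ.1ℤ) →
        SameSet V ((ℤ.0ℤ , ℤ.1ℤ) ∷ (- + r , s) ∷ (- + r , s - ℤ.1ℤ) ∷ (ℤ.0ℤ , ℤ.-1ℤ) ∷ (+ r , - s) ∷ []) → NormalForm r s V
  nf8 : Cop r s → Cop r (s ℤ.+ ℤ.1ℤ) →
        SameSet V ((ℤ.0ℤ , ℤ.1ℤ) ∷ (- + r , s ℤ.+ ℤ.1ℤ) ∷ (- + r , s) ∷ (+ r , - s - ℤ.1ℤ) ∷ (+ r , - s) ∷ []) → NormalForm r s V
  nf9 : Cop r s → Cop r (s ℤ.+ ℤ.1ℤ) →
        SameSet V ((ℤ.0ℤ , ℤ.1ℤ) ∷ (- + r , s ℤ.+ ℤ.1ℤ) ∷ (- + r , s) ∷ (ℤ.0ℤ , ℤ.-1ℤ) ∷ (+ r , - s - ℤ.1ℤ) ∷ (+ r , - s) ∷ []) → NormalForm r s V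

module Submission where

-- Since no edge cone of P contains a T-cone, every edge cone is its own residual R-cone, and
-- representing 1/r(1,s) forces |det (u , v)| = r for every edge (u , v).  Fix a vertex q.  Walking
-- around the boundary, the two neighbours of each vertex sum to an integer multiple of it, so every
-- height det (x , q) is a multiple of r; convexity makes these heights weakly decreasing from r
-- (just after q) to -r (just before q), so they lie in {-r , 0 , r}.  The heights relative to two
-- consecutive vertices v₀, v₁ determine a vertex, so P is encoded by a closed convex walk on the
-- nine symbols {-1 , 0 , 1}², and an exhaustive search of such walks leaves twelve of them, which
-- are the nine listed polygons and three mirror images.

open import Defs
open import Data.Nat as ℕ using (ℕ; zero; suc; _≤_; _<_; z≤n; s≤s)
import Data.Nat.Properties as ℕP
import Data.Nat.DivMod as ℕD
import Data.Nat.Divisibility as ℕ∣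
open import Data.Nat.GCD as GCD using (gcd; gcd-GCD; gcd[m,n]∣m; gcd[m,n]∣n; gcd[m,n]≡0⇒m≡0; gcd[m,n]≡0⇒n≡0)
open import Data.Nat.ListAction using (sum)
open import Data.Integer as ℤ using (ℤ; +_; -[1+_]; ∣_∣; _+_; _-_; -_; _*_; 0ℤ; 1ℤ; -1ℤ; +≤+; -≤-)
import Data.Integer.Properties as ℤP
open import Data.Integer.Divisibility.Signed using (_∣_; ∣ᵤ⇒∣; ∣⇒∣ᵤ; ∣m∣n⇒∣m+n; ∣n⇒∣m*n)
open import Data.Integer.Tactic.RingSolver using (solve-∀)
open import Data.Bool using (if_then_else_)
open import Data.Maybe using (Maybe; just)
open import Data.Product as Product using (Σ; _×_; _,_; proj₁; proj₂)
open import Data.Product.Properties using () renaming (≡-dec to ×-≡-dec)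
open import Data.Sum using (_⊎_; inj₁; inj₂; [_,_]′)
open import Data.List using (List; []; _∷_; _++_; [_]; _∷ʳ_; map; zip; mapMaybe; length; concatMap; filter; cartesianProduct)
import Data.List.Properties as Listₚ
open import Data.List.Relation.Unary.All as All using (All; []; _∷_; all?)
import Data.List.Relation.Unary.All.Properties as Allₚ
import Data.List.Relation.Unary.AllPairs as AllPairs
open import Data.List.Relation.Unary.Any using (here; there)
open import Data.List.Relation.Unary.Linked as Linked using (Linked; [-]; _∷_; linked?)
import Data.List.Relation.Unary.Linked.Properties as Linkedₚ
open import Data.List.Membership.Propositional using (_∈_)
open import Data.List.Membership.Propositional.Properties
  using (∈-++⁺ˡ; ∈-++⁺ʳ; ∈-map⁺; ∈-map⁻; ∈-concat⁺′; ∈-filter⁺; ∈-cartesianProduct⁺)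
import Data.List.Relation.Binary.Subset.Propositional.Properties as Subsetₚ
open import Function using (id; _∘_)
open import Relation.Binary.Definitions using (DecidableEquality)
open import Relation.Binary.PropositionalEquality hiding ([_])
open import Relation.Nullary using (Dec; yes; no; does; contradiction)
open import Relation.Nullary.Decidable using (True; map′; _×-dec_; _→-dec_; ¬?; toWitness; dec-true)
open import Relation.Unary using (Decidable)

-- Determinants and GL₂(ℤ)

detGL : GL2 → ℤ
detGL A = a₁₁ * a₂₂ - a₁₂ * a₂₁
  where open GL2 A

∣detGL∣≡1 : ∀ A → ∣ detGL A ∣ ≡ 1
∣detGL∣≡1 A with GL2.unimodular A
... | inj₁ D≡1  = cong ∣_∣ D≡1
... | inj₂ D≡-1 = cong ∣_∣ D≡-1

det-act : ∀ A u v → det (act A u) (act A v) ≡ detGL A * det u v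
det-act A (x , y) (z , w) = in-coordinates (GL2.a₁₁ A) (GL2.a₁₂ A) (GL2.a₂₁ A) (GL2.a₂₂ A) x y z w
  where
  in-coordinates : ∀ a b c d x y z w →
    (a * x + b * y) * (c * z + d * w) - (c * x + d * y) * (a * z + b * w) ≡ (a * d - b * c) * (x * w - y * z)
  in-coordinates = solve-∀

det-antisym : ∀ u v → det u v ≡ - det v u
det-antisym (a , b) (c , d) = in-coordinates a b c d
  where
  in-coordinates : ∀ a b c d → a * d - b * c ≡ - (c * b - d * a)
  in-coordinates = solve-∀

det-self : ∀ u → det u u ≡ 0ℤ
det-self (a , b) = in-coordinates a b
  where
  in-coordinates : ∀ a b → a * b - b * a ≡ 0ℤ
  in-coordinates = solve-∀

det-−ₚ : ∀ u v w → det (v −ₚ u) (w −ₚ u) ≡ det v w - det v u - det u w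
det-−ₚ (a , b) (c , d) (e , f) = in-coordinates a b c d e f
  where
  in-coordinates : ∀ a b c d e f →
    (c - a) * (f - b) - (d - b) * (e - a) ≡ (c * f - d * e) - (c * b - d * a) - (a * f - b * e)
  in-coordinates = solve-∀

det-+ₚˡ : ∀ u v w → det (u +ₚ v) w ≡ det u w + det v w
det-+ₚˡ (a , b) (c , d) (e , f) = in-coordinates a b c d e f
  where
  in-coordinates : ∀ a b c d e f → (a + c) * f - (b + d) * e ≡ (a * f - b * e) + (c * f - d * e)
  in-coordinates = solve-∀

det-·ₚ : ∀ k l u v → det (k ·ₚ u) (l ·ₚ v) ≡ (k * l) * det u v
det-·ₚ k l (a , b) (c , d) = in-coordinates k l a b c d
  where
  in-coordinates : ∀ k l a b c d → (k * a) * (l * d) - (k * b) * (l * c) ≡ (k * l) * (a * d - b * c)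
  in-coordinates = solve-∀

det-·ₚˡ : ∀ k u v → det (k ·ₚ u) v ≡ k * det u v
det-·ₚˡ k (a , b) (c , d) = in-coordinates k a b c d
  where
  in-coordinates : ∀ k a b c d → (k * a) * d - (k * b) * c ≡ k * (a * d - b * c)
  in-coordinates = solve-∀

det-plücker : ∀ u v x y → det u v * det x y ≡ det u x * det v y - det u y * det v x
det-plücker (a , b) (c , d) (e , f) (g , h) = in-coordinates a b c d e f g h
  where
  in-coordinates : ∀ a b c d e f g h →
    (a * d - b * c) * (e * h - f * g) ≡ (a * f - b * e) * (c * h - d * g) - (a * h - b * g) * (c * f - d * e)
  in-coordinates = solve-∀

det-·ₚ-self : ∀ k u → det (k ·ₚ u) u ≡ 0ℤ
det-·ₚ-self k u = trans (det-·ₚˡ k u u) (trans (cong (k *_) (det-self u)) (ℤP.*-zeroʳ k))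

∣det∣-act : ∀ A u v → ∣ det (act A u) (act A v) ∣ ≡ ∣ det u v ∣
∣det∣-act A u v = begin
  ∣ det (act A u) (act A v) ∣    ≡⟨ cong ∣_∣ (det-act A u v) ⟩
  ∣ detGL A * det u v ∣          ≡⟨ ℤP.abs-* (detGL A) (det u v) ⟩
  ∣ detGL A ∣ ℕ.* ∣ det u v ∣    ≡⟨ cong (ℕ._* ∣ det u v ∣) (∣detGL∣≡1 A) ⟩
  1 ℕ.* ∣ det u v ∣              ≡⟨ ℕP.*-identityˡ ∣ det u v ∣ ⟩
  ∣ det u v ∣                    ∎
  where open ≡-Reasoning

∣det∣-unit-multiples : ∀ c d u v → ∣ c ∣ ≡ 1 → ∣ d ∣ ≡ 1 → ∣ det (c ·ₚ u) (d ·ₚ v) ∣ ≡ ∣ det u v ∣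
∣det∣-unit-multiples c d u v ∣c∣≡1 ∣d∣≡1 = begin
  ∣ det (c ·ₚ u) (d ·ₚ v) ∣       ≡⟨ cong ∣_∣ (det-·ₚ c d u v) ⟩
  ∣ (c * d) * det u v ∣           ≡⟨ ℤP.abs-* (c * d) (det u v) ⟩
  ∣ c * d ∣ ℕ.* ∣ det u v ∣       ≡⟨ cong (ℕ._* ∣ det u v ∣) (ℤP.abs-* c d) ⟩
  ∣ c ∣ ℕ.* ∣ d ∣ ℕ.* ∣ det u v ∣ ≡⟨ cong₂ (λ x y → x ℕ.* y ℕ.* ∣ det u v ∣) ∣c∣≡1 ∣d∣≡1 ⟩
  1 ℕ.* 1 ℕ.* ∣ det u v ∣         ≡⟨ ℕP.+-identityʳ ∣ det u v ∣ ⟩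
  ∣ det u v ∣                     ∎
  where open ≡-Reasoning

act-·ₚ : ∀ A k u → act A (k ·ₚ u) ≡ k ·ₚ act A u
act-·ₚ A k (x , y) =
  cong₂ _,_ (in-coordinates (GL2.a₁₁ A) (GL2.a₁₂ A) k x y) (in-coordinates (GL2.a₂₁ A) (GL2.a₂₂ A) k x y)
  where
  in-coordinates : ∀ a b k x y → a * (k * x) + b * (k * y) ≡ k * (a * x + b * y)
  in-coordinates = solve-∀

±1-square : ∀ {D} → D ≡ 1ℤ ⊎ D ≡ -1ℤ → D * D ≡ 1ℤ
±1-square (inj₁ refl) = refl
±1-square (inj₂ refl) = refl

inverse : GL2 → GL2
inverse A = record
  { a₁₁ = D * a₂₂ ; a₁₂ = - (D * a₁₂) ; a₂₁ = - (D * a₂₁) ; a₂₂ = D * a₁₁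
  ; unimodular = subst (λ e → e ≡ 1ℤ ⊎ e ≡ -1ℤ) (sym det-inverse) unimodular }
  where
  open GL2 A
  D : ℤ
  D = detGL A
  cube : ∀ a b c d → ((a * d - b * c) * d) * ((a * d - b * c) * a) - (- ((a * d - b * c) * b)) * (- ((a * d - b * c) * c))
                       ≡ ((a * d - b * c) * (a * d - b * c)) * (a * d - b * c)
  cube = solve-∀
  det-inverse : (D * a₂₂) * (D * a₁₁) - (- (D * a₁₂)) * (- (D * a₂₁)) ≡ D
  det-inverse = trans (cube a₁₁ a₁₂ a₂₁ a₂₂) (trans (cong (_* D) (±1-square unimodular)) (ℤP.*-identityˡ D))

act-inverse : ∀ A p → act (inverse A) (act A p) ≡ p
act-inverse A (x , y) = cong₂ _,_
  (trans (first a₁₁ a₁₂ a₂₁ a₂₂ x y) (unit-scale x))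
  (trans (second a₁₁ a₁₂ a₂₁ a₂₂ x y) (unit-scale y))
  where
  open GL2 A
  unit-scale : ∀ z → (detGL A * detGL A) * z ≡ z
  unit-scale z = trans (cong (_* z) (±1-square unimodular)) (ℤP.*-identityˡ z)
  first : ∀ a b c d x y → ((a * d - b * c) * d) * (a * x + b * y) + (- ((a * d - b * c) * b)) * (c * x + d * y)
                            ≡ ((a * d - b * c) * (a * d - b * c)) * x
  first = solve-∀
  second : ∀ a b c d x y → (- ((a * d - b * c) * c)) * (a * x + b * y) + ((a * d - b * c) * a) * (c * x + d * y)
                             ≡ ((a * d - b * c) * (a * d - b * c)) * y
  second = solve-∀

act-injective : ∀ A {p q} → act A p ≡ act A q → p ≡ q
act-injective A {p} {q} e = begin
  p                             ≡⟨ act-inverse A p ⟨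
  act (inverse A) (act A p)     ≡⟨ cong (act (inverse A)) e ⟩
  act (inverse A) (act A q)     ≡⟨ act-inverse A q ⟩
  q                             ∎
  where open ≡-Reasoning

-- Primitive vectors

Bézout : Pt → Set
Bézout (a , b) = Σ ℤ λ m → Σ ℤ λ n → m * a + n * b ≡ 1ℤ

Bézout-act⁻¹ : ∀ A p → Bézout (act A p) → Bézout p
Bézout-act⁻¹ A (x , y) (m , n , eq) = m * a₁₁ + n * a₂₁ , m * a₁₂ + n * a₂₂ ,
  trans (regroup m n a₁₁ a₁₂ a₂₁ a₂₂ x y) eq
  where
  open GL2 A
  regroup : ∀ m n a b c d x y → (m * a + n * c) * x + (m * b + n * d) * y ≡ m * (a * x + b * y) + n * (c * x + d * y)
  regroup = solve-∀

act-Bézout : ∀ A p → Bézout p → Bézout (act A p)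
act-Bézout A p b = Bézout-act⁻¹ (inverse A) (act A p) (subst Bézout (sym (act-inverse A p)) b)

Bézout-·ₚ⇒∣∣≡1 : ∀ c p → Bézout (c ·ₚ p) → ∣ c ∣ ≡ 1
Bézout-·ₚ⇒∣∣≡1 c (x , y) (m , n , eq) =
  ℕP.m*n≡1⇒m≡1 ∣ c ∣ ∣ m * x + n * y ∣
    (trans (sym (ℤP.abs-* c (m * x + n * y))) (cong ∣_∣ (trans (regroup c m n x y) eq)))
  where
  regroup : ∀ c m n x y → c * (m * x + n * y) ≡ m * (c * x) + n * (c * y)
  regroup = solve-∀

det≡0⇒multiple : ∀ p q → Bézout q → det p q ≡ 0ℤ → Σ ℤ λ c → p ≡ c ·ₚ q
det≡0⇒multiple (x , y) (a , b) (m , n , eq) d≡0 = c , cong₂ _,_ first second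
  where
  c : ℤ
  c = m * x + n * y
  unit-and-zero : ∀ z w → z * (m * a + n * b) + w * (x * b - y * a) ≡ z
  unit-and-zero z w = begin
    z * (m * a + n * b) + w * (x * b - y * a) ≡⟨ cong₂ (λ u v → z * u + w * v) eq d≡0 ⟩
    z * 1ℤ + w * 0ℤ                           ≡⟨ cong₂ _+_ (ℤP.*-identityʳ z) (ℤP.*-zeroʳ w) ⟩
    z + 0ℤ                                    ≡⟨ ℤP.+-identityʳ z ⟩
    z                                         ∎
    where open ≡-Reasoning
  first-expanded : ∀ m n x y a b → (m * x + n * y) * a ≡ x * (m * a + n * b) + (- n) * (x * b - y * a)
  first-expanded = solve-∀
  second-expanded : ∀ m n x y a b → (m * x + n * y) * b ≡ y * (m * a + n * b) + m * (x * b - y * a)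
  second-expanded = solve-∀
  first : x ≡ c * a
  first = sym (trans (first-expanded m n x y a b) (unit-and-zero x (- n)))
  second : y ≡ c * b
  second = sym (trans (second-expanded m n x y a b) (unit-and-zero y m))

parallel-Bézout⇒unit-multiple : ∀ p q → Bézout p → Bézout q → det p q ≡ 0ℤ →
  Σ ℤ λ c → ∣ c ∣ ≡ 1 × p ≡ c ·ₚ q
parallel-Bézout⇒unit-multiple p q bp bq d≡0 with det≡0⇒multiple p q bq d≡0
... | c , refl = c , Bézout-·ₚ⇒∣∣≡1 c q bp , refl

Bézout⇒Primitive : ∀ p → Bézout p → Primitive p
Bézout⇒Primitive (a , b) (m , n , eq) = ℕ∣.∣1⇒≡1 (∣⇒∣ᵤ (subst (+ g ∣_) eq g∣ma+nb))
  where
  g : ℕ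
  g = gcd ∣ a ∣ ∣ b ∣
  g∣ma+nb : + g ∣ m * a + n * b
  g∣ma+nb = ∣m∣n⇒∣m+n (∣n⇒∣m*n m (∣ᵤ⇒∣ (gcd[m,n]∣m ∣ a ∣ ∣ b ∣)))
                      (∣n⇒∣m*n n (∣ᵤ⇒∣ (gcd[m,n]∣n ∣ a ∣ ∣ b ∣)))

+∣∣≡sign* : ∀ i → Σ ℤ λ σ → + ∣ i ∣ ≡ σ * i
+∣∣≡sign* (+ n)    = 1ℤ , sym (ℤP.*-identityˡ (+ n))
+∣∣≡sign* -[1+ n ] = -1ℤ , sym (ℤP.-1*i≡-i -[1+ n ])

Bézout-∣∣ : ∀ a b m n → m * + ∣ a ∣ + n * + ∣ b ∣ ≡ 1ℤ → Bézout (a , b)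
Bézout-∣∣ a b m n eq with +∣∣≡sign* a | +∣∣≡sign* b
... | σ , ea | τ , eb = m * σ , n * τ ,
  trans (regroup m n σ τ a b) (subst₂ (λ u v → m * u + n * v ≡ 1ℤ) ea eb eq)
  where
  regroup : ∀ m n σ τ a b → (m * σ) * a + (n * τ) * b ≡ m * (σ * a) + n * (τ * b)
  regroup = solve-∀

ℕ-identity⇒ℤ : ∀ x y p q → 1 ℕ.+ y ℕ.* q ≡ x ℕ.* p → + x * + p + (- + y) * + q ≡ 1ℤ
ℕ-identity⇒ℤ x y p q eq = cancel (+ x * + p) (+ y) (+ q) (begin
  + x * + p              ≡⟨ ℤP.pos-* x p ⟨
  + (x ℕ.* p)            ≡⟨ cong +_ eq ⟨
  + (1 ℕ.+ y ℕ.* q)      ≡⟨ ℤP.pos-+ 1 (y ℕ.* q) ⟩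
  1ℤ + + (y ℕ.* q)       ≡⟨ cong (λ z → 1ℤ + z) (ℤP.pos-* y q) ⟩
  1ℤ + + y * + q         ∎)
  where
  open ≡-Reasoning
  cancel : ∀ X y q → X ≡ 1ℤ + y * q → X + (- y) * q ≡ 1ℤ
  cancel .(1ℤ + y * q) y q refl = cancelled y q
    where
    cancelled : ∀ y q → (1ℤ + y * q) + (- y) * q ≡ 1ℤ
    cancelled = solve-∀

Primitive⇒Bézout : ∀ p → Primitive p → Bézout p
Primitive⇒Bézout (a , b) prim with GCD.Bézout.identity (gcd-GCD ∣ a ∣ ∣ b ∣)
... | GCD.Bézout.+- x y eq = Bézout-∣∣ a b (+ x) (- + y)
        (ℕ-identity⇒ℤ x y ∣ a ∣ ∣ b ∣ (subst (λ g → g ℕ.+ y ℕ.* ∣ b ∣ ≡ x ℕ.* ∣ a ∣) prim eq))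
... | GCD.Bézout.-+ x y eq = Bézout-∣∣ a b (- + x) (+ y)
        (trans (ℤP.+-comm (- + x * + ∣ a ∣) (+ y * + ∣ b ∣))
          (ℕ-identity⇒ℤ y x ∣ b ∣ ∣ a ∣ (subst (λ g → g ℕ.+ x ℕ.* ∣ a ∣ ≡ y ℕ.* ∣ b ∣) prim eq)))

-- Edge cones without T-cones

div≡0⇒mod≡id : ∀ m n → m div n ≡ 0 → m mod n ≡ m
div≡0⇒mod≡id m zero    _     = refl
div≡0⇒mod≡id m (suc n) m/n≡0 = sym (begin
  m                                          ≡⟨ ℕD.m≡m%n+[m/n]*n m (suc n) ⟩
  m ℕD.% suc n ℕ.+ (m ℕD./ suc n) ℕ.* suc n  ≡⟨ cong (λ q → m ℕD.% suc n ℕ.+ q ℕ.* suc n) m/n≡0 ⟩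
  m ℕD.% suc n ℕ.+ 0                         ≡⟨ ℕP.+-identityʳ _ ⟩
  m ℕD.% suc n                               ∎)
  where open ≡-Reasoning

ℓ≢0 : ∀ u v → det u v ≢ 0ℤ → ℓ (u , v) ≢ 0
ℓ≢0 (a , b) (c , d) det≢0 ℓ≡0 = det≢0 (subst₂ (λ x y → det (x , y) (c , d) ≡ 0ℤ) c≡a d≡b (det-self (c , d)))
  where
  c≡a : c ≡ a
  c≡a = ℤP.i-j≡0⇒i≡j c a (ℤP.∣i∣≡0⇒i≡0 (gcd[m,n]≡0⇒m≡0 ℓ≡0))
  d≡b : d ≡ b
  d≡b = ℤP.i-j≡0⇒i≡j d b (ℤP.∣i∣≡0⇒i≡0 (gcd[m,n]≡0⇒n≡0 ∣ c - a ∣ ℓ≡0))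

residual-unfold : ∀ C → ρ C ≢ 0 →
  residual C ≡ just (((+ (ℓ C ℕ.∸ nT C ℕ.* h C)) ·ₚ proj₁ C) +ₚ ((+ (nT C ℕ.* h C)) ·ₚ proj₂ C) , proj₂ C)
residual-unfold C ρ≢0 with ρ C
... | zero  = contradiction refl ρ≢0
... | suc _ = refl

+ₚ-identityʳ : ∀ p → p +ₚ (0ℤ , 0ℤ) ≡ p
+ₚ-identityʳ (a , b) = cong₂ _,_ (ℤP.+-identityʳ a) (ℤP.+-identityʳ b)

residual-without-T-cones : ∀ u v → nT (u , v) ≡ 0 → det u v ≢ 0ℤ →
  residual (u , v) ≡ just ((+ ℓ (u , v)) ·ₚ u , v)
residual-without-T-cones u v n≡0 det≢0 = begin
  residual (u , v)
    ≡⟨ residual-unfold (u , v) (subst (_≢ 0) (sym (div≡0⇒mod≡id (ℓ (u , v)) (h (u , v)) n≡0)) (ℓ≢0 u v det≢0)) ⟩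
  just (((+ (ℓ (u , v) ℕ.∸ nT (u , v) ℕ.* h (u , v))) ·ₚ u) +ₚ ((+ (nT (u , v) ℕ.* h (u , v))) ·ₚ v) , v)
    ≡⟨ cong (λ n → just (((+ (ℓ (u , v) ℕ.∸ n ℕ.* h (u , v))) ·ₚ u) +ₚ ((+ (n ℕ.* h (u , v))) ·ₚ v) , v)) n≡0 ⟩
  just (((+ ℓ (u , v)) ·ₚ u) +ₚ (0ℤ , 0ℤ) , v)
    ≡⟨ cong (λ p → just (p , v)) (+ₚ-identityʳ _) ⟩
  just ((+ ℓ (u , v)) ·ₚ u , v) ∎
  where open ≡-Reasoning

scaled-image⇒det≡0 : ∀ A k u m e → k ≢ 0ℤ → act A (k ·ₚ u) ≡ m ·ₚ e → det (act A u) e ≡ 0ℤ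
scaled-image⇒det≡0 A k u m e k≢0 image =
  [ (λ k≡0 → contradiction k≡0 k≢0) , id ]′ (ℤP.i*j≡0⇒i≡0∨j≡0 k k*d≡0)
  where
  k*d≡0 : k * det (act A u) e ≡ 0ℤ
  k*d≡0 = begin
    k * det (act A u) e        ≡⟨ det-·ₚˡ k (act A u) e ⟨
    det (k ·ₚ act A u) e       ≡⟨ cong (λ p → det p e) (act-·ₚ A k u) ⟨
    det (act A (k ·ₚ u)) e     ≡⟨ cong (λ p → det p e) image ⟩
    det (m ·ₚ e) e             ≡⟨ det-·ₚ-self m e ⟩
    0ℤ                         ∎
    where open ≡-Reasoning

∣det∣-of-images : ∀ A u v k m n e f → k ≢ 0ℤ → Bézout u → Bézout v → Bézout e → Bézout f →
  act A (k ·ₚ u) ≡ m ·ₚ e → act A v ≡ n ·ₚ f → ∣ det u v ∣ ≡ ∣ det e f ∣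
∣det∣-of-images A u v k m n e f k≢0 bu bv be bf ku↦e v↦f = begin
  ∣ det u v ∣                         ≡⟨ ∣det∣-act A u v ⟨
  ∣ det (act A u) (act A v) ∣         ≡⟨ cong₂ (λ p q → ∣ det p q ∣) u↦ce v↦df ⟩
  ∣ det (c ·ₚ e) (d ·ₚ f) ∣           ≡⟨ ∣det∣-unit-multiples c d e f ∣c∣≡1 ∣d∣≡1 ⟩
  ∣ det e f ∣                         ∎
  where
  open ≡-Reasoning
  u-unit : Σ ℤ λ c → ∣ c ∣ ≡ 1 × act A u ≡ c ·ₚ e
  u-unit = parallel-Bézout⇒unit-multiple (act A u) e (act-Bézout A u bu) be (scaled-image⇒det≡0 A k u m e k≢0 ku↦e)
  v-unit : Σ ℤ λ d → ∣ d ∣ ≡ 1 × act A v ≡ d ·ₚ f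
  v-unit = parallel-Bézout⇒unit-multiple (act A v) f (act-Bézout A v bv) bf
             (subst (λ p → det p f ≡ 0ℤ) (sym v↦f) (det-·ₚ-self n f))
  c d : ℤ
  c = proj₁ u-unit
  d = proj₁ v-unit
  ∣c∣≡1 : ∣ c ∣ ≡ 1
  ∣c∣≡1 = proj₁ (proj₂ u-unit)
  ∣d∣≡1 : ∣ d ∣ ≡ 1
  ∣d∣≡1 = proj₁ (proj₂ v-unit)
  u↦ce : act A u ≡ c ·ₚ e
  u↦ce = proj₂ (proj₂ u-unit)
  v↦df : act A v ≡ d ·ₚ f
  v↦df = proj₂ (proj₂ v-unit)

e₁ : Pt
e₁ = (0ℤ , 1ℤ)

e₂ : ℕ → ℕ → Pt
e₂ r s = (+ r , - (+ s))

Bézout-e₁ : Bézout e₁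
Bézout-e₁ = 0ℤ , 1ℤ , refl

Bézout-e₂ : ∀ r s → gcd r s ≡ 1 → Bézout (e₂ r s)
Bézout-e₂ r s cop = Primitive⇒Bézout (e₂ r s) (trans (cong (gcd r) (ℤP.∣-i∣≡∣i∣ (+ s))) cop)

det-e₁e₂ : ∀ r s → det e₁ (e₂ r s) ≡ - + r
det-e₁e₂ r s = in-coordinates (+ r) (+ s)
  where
  in-coordinates : ∀ r s → 0ℤ * (- s) - 1ℤ * r ≡ - r
  in-coordinates = solve-∀

det-e₂e₁ : ∀ r s → det (e₂ r s) e₁ ≡ + r
det-e₂e₁ r s = in-coordinates (+ r) (+ s)
  where
  in-coordinates : ∀ r s → r * 1ℤ - (- s) * 0ℤ ≡ r
  in-coordinates = solve-∀

Represents⇒∣det∣≡r : ∀ u v k r s → k ≢ 0ℤ → Bézout u → Bézout v → gcd r s ≡ 1 →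
  Represents (k ·ₚ u , v) r s → ∣ det u v ∣ ≡ r
Represents⇒∣det∣≡r u v k r s k≢0 bu bv cop (A , a , b , inj₁ (ku↦e₁ , v↦e₂)) =
  trans (∣det∣-of-images A u v k (+ suc a) (+ suc b) e₁ (e₂ r s) k≢0 bu bv Bézout-e₁ (Bézout-e₂ r s cop) ku↦e₁ v↦e₂)
        (trans (cong ∣_∣ (det-e₁e₂ r s)) (ℤP.∣-i∣≡∣i∣ (+ r)))
Represents⇒∣det∣≡r u v k r s k≢0 bu bv cop (A , a , b , inj₂ (ku↦e₂ , v↦e₁)) =
  trans (∣det∣-of-images A u v k (+ suc a) (+ suc b) (e₂ r s) e₁ k≢0 bu bv (Bézout-e₂ r s cop) Bézout-e₁ ku↦e₂ v↦e₁)
        (cong ∣_∣ (det-e₂e₁ r s))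

sum≡0⇒All≡0 : ∀ {A : Set} (f : A → ℕ) xs → sum (map f xs) ≡ 0 → All (λ x → f x ≡ 0) xs
sum≡0⇒All≡0 f []       _  = []
sum≡0⇒All≡0 f (x ∷ xs) eq = ℕP.m+n≡0⇒m≡0 (f x) eq ∷ sum≡0⇒All≡0 f xs (ℕP.m+n≡0⇒n≡0 (f x) eq)

mapMaybe-just : ∀ {A B : Set} (f : A → Maybe B) (g : A → B) xs →
  All (λ x → f x ≡ just (g x)) xs → mapMaybe f xs ≡ map g xs
mapMaybe-just f g []       []         = refl
mapMaybe-just f g (x ∷ xs) (fx ∷ fxs) rewrite fx = cong (g x ∷_) (mapMaybe-just f g xs fxs)

All-zip : ∀ {A : Set} {P : A → Set} xs ys → All P xs → All P ys → All (λ e → P (proj₁ e) × P (proj₂ e)) (zip xs ys)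
All-zip []       ys       _          _          = []
All-zip (x ∷ xs) []       _          _          = []
All-zip (x ∷ xs) (y ∷ ys) (px ∷ pxs) (py ∷ pys) = (px , py) ∷ All-zip xs ys pxs pys

All-rotate : ∀ {P : Pt → Set} vs → All P vs → All P (rotate vs)
All-rotate []       []         = []
All-rotate (v ∷ vs) (pv ∷ pvs) = Allₚ.∷ʳ⁺ pvs pv

All-edges : ∀ {P : Pt → Set} vs → All P vs → All (λ e → P (proj₁ e) × P (proj₂ e)) (edges vs)
All-edges vs pvs = All-zip vs (rotate vs) pvs (All-rotate vs pvs)

zip-walk : ∀ {A : Set} {R : A → A → Set} a l b → All (λ e → R (proj₁ e) (proj₂ e)) (zip (a ∷ l) (l ∷ʳ b)) →
  Linked R (a ∷ l ∷ʳ b)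
zip-walk a []      b (rab ∷ [])  = rab ∷ [-]
zip-walk a (c ∷ l) b (rac ∷ rs) = rac ∷ zip-walk c l b rs

length-zip-walk : ∀ {A : Set} (a : A) l b → length (zip (a ∷ l) (l ∷ʳ b)) ≡ suc (length l)
length-zip-walk a []      b = refl
length-zip-walk a (c ∷ l) b = cong suc (length-zip-walk c l b)

Linked-∷ʳ : ∀ {A : Set} {R : A → A → Set} x xs {a b} → Linked R (x ∷ xs ∷ʳ a) → R a b →
  Linked R (x ∷ (xs ∷ʳ a) ∷ʳ b)
Linked-∷ʳ x []       (rxa ∷ [-]) rab = rxa ∷ rab ∷ [-]
Linked-∷ʳ x (y ∷ xs) (rxy ∷ ry)  rab = rxy ∷ Linked-∷ʳ y xs ry rab

scaled : Cone → Cone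
scaled (u , v) = ((+ ℓ (u , v)) ·ₚ u , v)

basket-without-T-cones : ∀ vs → Fano vs → proj₁ (SC vs) ≡ 0 → proj₂ (SC vs) ≡ map scaled (edges vs)
basket-without-T-cones vs F no-T = mapMaybe-just residual scaled (edges vs)
  (All.zipWith (λ { {u , v} (n≡0 , det<0) → residual-without-T-cones u v n≡0 (ℤP.<⇒≢ det<0) })
               (sum≡0⇒All≡0 nT (edges vs) no-T , Fano.originIn F))

i<0∧∣i∣≡n⇒i≡-n : ∀ {i n} → i ℤ.< 0ℤ → ∣ i ∣ ≡ n → i ≡ - + n
i<0∧∣i∣≡n⇒i≡-n { -[1+ _ ]} _          refl = refl
i<0∧∣i∣≡n⇒i≡-n {+ _}       (ℤ.+<+ ()) _

edge-det≡-r : ∀ r vs → Fano vs → proj₁ (SC vs) ≡ 0 →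
  All (λ C → Σ ℕ λ s → 1 ≤ s × s < r × gcd r s ≡ 1 × Represents C r s) (proj₂ (SC vs)) →
  All (λ e → det (proj₁ e) (proj₂ e) ≡ - + r) (edges vs)
edge-det≡-r r vs F no-T reps =
  All.zipWith edge (All.zip (Fano.originIn F , All-edges vs (All.map (Primitive⇒Bézout _) (Fano.primVerts F))) ,
                    Allₚ.map⁻ (subst (All _) (basket-without-T-cones vs F no-T) reps))
  where
  edge : ∀ {e} → ((det (proj₁ e) (proj₂ e) ℤ.< 0ℤ) × Bézout (proj₁ e) × Bézout (proj₂ e)) ×
                   (Σ ℕ λ s → 1 ≤ s × s < r × gcd r s ≡ 1 × Represents (scaled e) r s) →
         det (proj₁ e) (proj₂ e) ≡ - + r
  edge {u , v} ((det<0 , bu , bv) , s , _ , _ , cop , rep) =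
    i<0∧∣i∣≡n⇒i≡-n det<0 (Represents⇒∣det∣≡r u v (+ ℓ (u , v)) r s ℓ≢0ℤ bu bv cop rep)
    where
    ℓ≢0ℤ : + ℓ (u , v) ≢ 0ℤ
    ℓ≢0ℤ eq = ℓ≢0 u v (ℤP.<⇒≢ det<0) (ℤP.+-injective eq)

-- Heights of the vertices above a fixed vertex

data Tri : Set where
  t⁻ t⁰ t⁺ : Tri

⟦_⟧ : Tri → ℤ
⟦ t⁻ ⟧ = -1ℤ
⟦ t⁰ ⟧ = 0ℤ
⟦ t⁺ ⟧ = 1ℤ

⟦⟧-injective : ∀ {t u} → ⟦ t ⟧ ≡ ⟦ u ⟧ → t ≡ u
⟦⟧-injective {t⁻} {t⁻} _ = refl
⟦⟧-injective {t⁰} {t⁰} _ = refl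
⟦⟧-injective {t⁺} {t⁺} _ = refl
⟦⟧-injective {t⁻} {t⁰} ()
⟦⟧-injective {t⁻} {t⁺} ()
⟦⟧-injective {t⁰} {t⁻} ()
⟦⟧-injective {t⁰} {t⁺} ()
⟦⟧-injective {t⁺} {t⁻} ()
⟦⟧-injective {t⁺} {t⁰} ()

_≟ᵗ_ : DecidableEquality Tri
t ≟ᵗ u = map′ ⟦⟧-injective (cong ⟦_⟧) (⟦ t ⟧ ℤ.≟ ⟦ u ⟧)

-1≤i≤1⇒Tri : ∀ i → -1ℤ ℤ.≤ i → i ℤ.≤ 1ℤ → Σ Tri λ t → i ≡ ⟦ t ⟧
-1≤i≤1⇒Tri (+ zero)        _        _                = t⁰ , refl
-1≤i≤1⇒Tri (+ suc zero)    _        _                = t⁺ , refl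
-1≤i≤1⇒Tri (+ suc (suc _)) _        (+≤+ (s≤s ()))
-1≤i≤1⇒Tri -[1+ zero ]     _        _                = t⁻ , refl
-1≤i≤1⇒Tri -[1+ suc _ ]    (-≤- ()) _

*⟦t⁻⟧ : ∀ i → i * ⟦ t⁻ ⟧ ≡ - i
*⟦t⁻⟧ i = trans (ℤP.*-comm i -1ℤ) (ℤP.-1*i≡-i i)

+n*i<0⇒i<0 : ∀ n i → + n * i ℤ.< 0ℤ → i ℤ.< 0ℤ
+n*i<0⇒i<0 n i ni<0 = ℤP.*-cancelˡ-<-nonNeg (+ n) (subst (+ n * i ℤ.<_) (sym (ℤP.*-zeroʳ (+ n))) ni<0)

i-1-j<0⇒i≤j : ∀ i j → i - 1ℤ - j ℤ.< 0ℤ → i ℤ.≤ j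
i-1-j<0⇒i≤j i j lt = ℤP.i-j≤0⇒i≤j (subst (ℤ._≤ 0ℤ) (regroup i j) (ℤP.i<j⇒suc[i]≤j lt))
  where
  regroup : ∀ i j → 1ℤ + (i - 1ℤ - j) ≡ i - j
  regroup = solve-∀

module Heights (r : ℕ) .{{_ : ℕ.NonZero r}} (Edge : Pt → Pt → Set) (q : Pt)
  (edge-det : ∀ {a b} → Edge a b → det a b ≡ - + r)
  (edge-supports : ∀ {a b} → Edge a b → q ≢ a → q ≢ b → det (b −ₚ a) (q −ₚ a) ℤ.< 0ℤ) where

  R : ℤ
  R = + r

  Height : Pt → Set
  Height x = Σ Tri λ t → det x q ≡ R * ⟦ t ⟧

  next-height : ∀ {p c x} tp tc → Edge p c → Edge c x → Bézout c →
    det p q ≡ R * tp → det c q ≡ R * tc → Σ ℤ λ t → det x q ≡ R * t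
  next-height {p} {c} {x} tp tc pc cx bc dp dc = k * tc - tp , (begin
    det x q                        ≡⟨ add-and-subtract (det p q) (det x q) ⟩
    det p q + det x q - det p q    ≡⟨ cong (_- det p q) (det-+ₚˡ p x q) ⟨
    det (p +ₚ x) q - det p q       ≡⟨ cong (λ y → det y q - det p q) p+x≡kc ⟩
    det (k ·ₚ c) q - det p q       ≡⟨ cong₂ _-_ (trans (det-·ₚˡ k c q) (cong (k *_) dc)) dp ⟩
    k * (R * tc) - R * tp          ≡⟨ factor k R tc tp ⟩
    R * (k * tc - tp)              ∎)
    where
    open ≡-Reasoning
    add-and-subtract : ∀ a b → b ≡ a + b - a
    add-and-subtract = solve-∀
    factor : ∀ k r t s → k * (r * t) - r * s ≡ r * (k * t - s)
    factor = solve-∀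
    p+x∥c : det (p +ₚ x) c ≡ 0ℤ
    p+x∥c = begin
      det (p +ₚ x) c    ≡⟨ det-+ₚˡ p x c ⟩
      det p c + det x c ≡⟨ cong₂ _+_ (edge-det pc) (trans (det-antisym x c) (cong -_ (edge-det cx))) ⟩
      - R + - - R       ≡⟨ cong (λ z → - R + z) (ℤP.neg-involutive R) ⟩
      - R + R           ≡⟨ ℤP.+-inverseˡ R ⟩
      0ℤ                ∎
    k : ℤ
    k = proj₁ (det≡0⇒multiple (p +ₚ x) c bc p+x∥c)
    p+x≡kc : p +ₚ x ≡ k ·ₚ c
    p+x≡kc = proj₂ (det≡0⇒multiple (p +ₚ x) c bc p+x∥c)

  height-decreasing : ∀ {c x} tc t → Edge c x → q ≢ c → q ≢ x →
    det c q ≡ R * tc → det x q ≡ R * t → t ℤ.≤ tc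
  height-decreasing {c} {x} tc t cx q≢c q≢x dc dx =
    i-1-j<0⇒i≤j t tc (+n*i<0⇒i<0 r _ (subst (ℤ._< 0ℤ) expand (edge-supports cx q≢c q≢x)))
    where
    open ≡-Reasoning
    factor : ∀ R t s → R * t - R - R * s ≡ R * (t - 1ℤ - s)
    factor = solve-∀
    expand : det (x −ₚ c) (q −ₚ c) ≡ R * (t - 1ℤ - tc)
    expand = begin
      det (x −ₚ c) (q −ₚ c)       ≡⟨ det-−ₚ c x q ⟩
      det x q - det x c - det c q ≡⟨ cong₂ (λ y z → y - det x c - z) dx dc ⟩
      R * t - det x c - R * tc    ≡⟨ cong (λ y → R * t - y - R * tc)
                                         (trans (det-antisym x c) (trans (cong -_ (edge-det cx)) (ℤP.neg-involutive R))) ⟩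
      R * t - R - R * tc          ≡⟨ factor R t tc ⟩
      R * (t - 1ℤ - tc)           ∎

  -- Along the walk from c to q the heights are weakly decreasing and end at -1, so they stay in [-1 , 1].
  heights : ∀ p c xs tp tc → Linked Edge (p ∷ c ∷ xs ∷ʳ q) → All Bézout (c ∷ xs) → All (q ≢_) (c ∷ xs) →
    det p q ≡ R * tp → det c q ≡ R * tc → tc ℤ.≤ 1ℤ → -1ℤ ℤ.≤ tc × All Height (c ∷ xs)
  heights p c [] tp tc (_ ∷ cq ∷ [-]) _ _ _ dc _ =
    ℤP.≤-reflexive (sym tc≡-1) , (t⁻ , trans dc (cong (R *_) tc≡-1)) ∷ []
    where
    tc≡-1 : tc ≡ -1ℤ
    tc≡-1 = ℤP.*-cancelˡ-≡ R tc -1ℤ (trans (sym dc) (trans (edge-det cq) (sym (*⟦t⁻⟧ R))))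
  heights p c (x ∷ xs) tp tc (pc ∷ cx ∷ walk) (bc ∷ bxs) (q≢c ∷ q≢xs) dp dc tc≤1 =
    ℤP.≤-trans -1≤t t≤tc , (proj₁ c-height , trans dc (cong (R *_) (proj₂ c-height))) ∷ proj₂ later
    where
    t : ℤ
    t = proj₁ (next-height tp tc pc cx bc dp dc)
    dx : det x q ≡ R * t
    dx = proj₂ (next-height tp tc pc cx bc dp dc)
    t≤tc : t ℤ.≤ tc
    t≤tc = height-decreasing tc t cx q≢c (All.head q≢xs) dc dx
    later : -1ℤ ℤ.≤ t × All Height (x ∷ xs)
    later = heights c x xs tc t (cx ∷ walk) bxs q≢xs dc dx (ℤP.≤-trans t≤tc tc≤1)
    -1≤t : -1ℤ ℤ.≤ t
    -1≤t = proj₁ later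
    c-height : Σ Tri λ τ → tc ≡ ⟦ τ ⟧
    c-height = -1≤i≤1⇒Tri tc (ℤP.≤-trans -1≤t t≤tc) tc≤1

-- Symbolic polygons

-- The code of a vertex x: its heights det x v₀ and det x v₁ divided by r, for the consecutive
-- vertices v₀, v₁ fixed below; V₀ and V₁ are the codes of v₀ and v₁ themselves.
S : Set
S = Tri × Tri

_≟ˢ_ : DecidableEquality S
_≟ˢ_ = ×-≡-dec _≟ᵗ_ _≟ᵗ_

open import Data.List.Membership.DecPropositional (Listₚ.≡-dec _≟ˢ_) using (_∈?_)
open import Data.List.Relation.Binary.Subset.DecPropositional _≟ˢ_ using (_⊆?_)

dS : S → S → ℤ
dS (a₀ , a₁) (b₀ , b₁) = ⟦ a₁ ⟧ * ⟦ b₀ ⟧ - ⟦ a₀ ⟧ * ⟦ b₁ ⟧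

convS : S → S → S → ℤ
convS a b c = dS b c - dS b a - dS a c

V₀ V₁ : S
V₀ = (t⁰ , t⁻)
V₁ = (t⁺ , t⁰)

SymEdge : List S → S → S → Set
SymEdge K a b = dS a b ≡ -1ℤ × All (λ c → c ≢ a → c ≢ b → convS a b c ℤ.< 0ℤ) K

SymbolicPolygon : List S → Set
SymbolicPolygon ks = Linked (SymEdge (V₀ ∷ V₁ ∷ ks)) (V₀ ∷ V₁ ∷ ks ∷ʳ V₀)

symbolic-polygon? : Decidable SymbolicPolygon
symbolic-polygon? ks = linked? symEdge? (V₀ ∷ V₁ ∷ ks ∷ʳ V₀)
  where
  symEdge? : ∀ a b → Dec (SymEdge (V₀ ∷ V₁ ∷ ks) a b)
  symEdge? a b = dS a b ℤ.≟ -1ℤ ×-dec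
    all? (λ c → ¬? (c ≟ˢ a) →-dec ¬? (c ≟ˢ b) →-dec convS a b c ℤ.<? 0ℤ) (V₀ ∷ V₁ ∷ ks)

-- Start, Step and Finish test convexity only against V₀ and V₁: weak enough to be checked edge by
-- edge, strong enough to make the weight drop along every step, which bounds the search below.
Start : S → Set
Start k = dS V₁ k ≡ -1ℤ × convS V₁ k V₀ ℤ.< 0ℤ

Step : S → S → Set
Step a b = dS a b ≡ -1ℤ × convS a b V₀ ℤ.< 0ℤ × convS a b V₁ ℤ.< 0ℤ

Finish : S → Set
Finish a = dS a V₀ ≡ -1ℤ × convS a V₀ V₁ ℤ.< 0ℤ

start? : Decidable Start
start? k = dS V₁ k ℤ.≟ -1ℤ ×-dec convS V₁ k V₀ ℤ.<? 0ℤ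

step? : ∀ a → Decidable (Step a)
step? a b = dS a b ℤ.≟ -1ℤ ×-dec convS a b V₀ ℤ.<? 0ℤ ×-dec convS a b V₁ ℤ.<? 0ℤ

finish? : Decidable Finish
finish? a = dS a V₀ ℤ.≟ -1ℤ ×-dec convS a V₀ V₁ ℤ.<? 0ℤ

data Chain : S → List S → Set where
  finish : ∀ {a} → Finish a → Chain a []
  step   : ∀ {a b ks} → Step a b → Chain b ks → Chain a (b ∷ ks)

tris : List Tri
tris = t⁻ ∷ t⁰ ∷ t⁺ ∷ []

∈-tris : ∀ t → t ∈ tris
∈-tris t⁻ = here refl
∈-tris t⁰ = there (here refl)
∈-tris t⁺ = there (there (here refl))

allS : List S
allS = cartesianProduct tris tris

∈-allS : ∀ a → a ∈ allS
∈-allS (a₀ , a₁) = ∈-cartesianProduct⁺ (∈-tris a₀) (∈-tris a₁)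

rank : Tri → ℕ
rank t⁻ = 0
rank t⁰ = 1
rank t⁺ = 2

weight : S → ℕ
weight (a₀ , a₁) = rank a₀ ℕ.+ rank a₁

weight≤4 : ∀ a → weight a ≤ 4
weight≤4 (a₀ , a₁) = ℕP.+-mono-≤ (rank≤2 a₀) (rank≤2 a₁)
  where
  rank≤2 : ∀ t → rank t ≤ 2
  rank≤2 t⁻ = z≤n
  rank≤2 t⁰ = s≤s z≤n
  rank≤2 t⁺ = s≤s (s≤s z≤n)

step-descends : ∀ a b → Step a b → weight b < weight a
step-descends a b = All.lookup (All.lookup table (∈-allS a)) (∈-allS b)
  where
  table : All (λ a → All (λ b → Step a b → weight b < weight a) allS) allS
  table = toWitness {a? = all? (λ a → all? (λ b → step? a b →-dec weight b ℕ.<? weight a) allS) allS} _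

finishing : S → List (List S)
finishing a = if does (finish? a) then [ [] ] else []

chains : ℕ → S → List (List S)
chains zero    a = finishing a
chains (suc n) a = finishing a ++ concatMap (λ b → map (b ∷_) (chains n b)) (filter (step? a) allS)

[]∈finishing : ∀ a → Finish a → [] ∈ finishing a
[]∈finishing a fin rewrite dec-true (finish? a) fin = here refl

Chain⇒∈chains : ∀ n {a ks} → weight a ≤ n → Chain a ks → ks ∈ chains n a
Chain⇒∈chains zero    {a} _   (finish fin) = []∈finishing a fin
Chain⇒∈chains (suc n) {a} _   (finish fin) = ∈-++⁺ˡ ([]∈finishing a fin)
Chain⇒∈chains zero    {a} w≤0 (step {b = b} ab _) =
  contradiction (ℕP.<-≤-trans (step-descends a b ab) w≤0) ℕP.n≮0
Chain⇒∈chains (suc n) {a} w≤n (step {b = b} ab chain) = ∈-++⁺ʳ (finishing a)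
  (∈-concat⁺′ (∈-map⁺ (b ∷_) (Chain⇒∈chains n (ℕP.≤-pred (ℕP.<-≤-trans (step-descends a b ab) w≤n)) chain))
              (∈-map⁺ (λ b → map (b ∷_) (chains n b)) (∈-filter⁺ (step? a) (∈-allS b) ab)))

candidates : List (List S)
candidates = concatMap (λ k → map (k ∷_) (chains 4 k)) (filter start? allS)

normal-chains : List (List S)
normal-chains =
  ((t⁻ , t⁺) ∷ []) ∷
  ((t⁻ , t⁺) ∷ (t⁻ , t⁰) ∷ []) ∷
  ((t⁰ , t⁺) ∷ (t⁻ , t⁻) ∷ []) ∷
  ((t⁰ , t⁺) ∷ (t⁻ , t⁰) ∷ []) ∷
  ((t⁰ , t⁺) ∷ (t⁻ , t⁰) ∷ (t⁻ , t⁻) ∷ []) ∷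
  ((t⁰ , t⁺) ∷ (t⁻ , t⁺) ∷ []) ∷
  ((t⁰ , t⁺) ∷ (t⁻ , t⁺) ∷ (t⁻ , t⁰) ∷ []) ∷
  ((t⁺ , t⁺) ∷ (t⁻ , t⁰) ∷ []) ∷
  ((t⁺ , t⁺) ∷ (t⁻ , t⁰) ∷ (t⁻ , t⁻) ∷ []) ∷
  ((t⁺ , t⁺) ∷ (t⁰ , t⁺) ∷ (t⁻ , t⁻) ∷ []) ∷
  ((t⁺ , t⁺) ∷ (t⁰ , t⁺) ∷ (t⁻ , t⁰) ∷ []) ∷
  ((t⁺ , t⁺) ∷ (t⁰ , t⁺) ∷ (t⁻ , t⁰) ∷ (t⁻ , t⁻) ∷ []) ∷
  []

candidates-classified : All (λ ks → SymbolicPolygon ks → ks ∈ normal-chains) candidates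
candidates-classified = toWitness {a? = all? (λ ks → symbolic-polygon? ks →-dec ks ∈? normal-chains) candidates} _

walk⇒Chain : ∀ {K} a ks → V₀ ∈ K → V₁ ∈ K → a ≢ V₀ → a ≢ V₁ → All (λ c → c ≢ V₀ × c ≢ V₁) ks →
  Linked (SymEdge K) (a ∷ ks ∷ʳ V₀) → Chain a ks
walk⇒Chain a [] V₀∈K V₁∈K a≢V₀ a≢V₁ [] ((d , supports) ∷ [-]) =
  finish (d , All.lookup supports V₁∈K (λ e → a≢V₁ (sym e)) λ ())
walk⇒Chain a (b ∷ ks) V₀∈K V₁∈K a≢V₀ a≢V₁ ((b≢V₀ , b≢V₁) ∷ avoid) ((d , supports) ∷ walk) =
  step (d , All.lookup supports V₀∈K (λ e → a≢V₀ (sym e)) (λ e → b≢V₀ (sym e))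
          , All.lookup supports V₁∈K (λ e → a≢V₁ (sym e)) (λ e → b≢V₁ (sym e)))
       (walk⇒Chain b ks V₀∈K V₁∈K b≢V₀ b≢V₁ avoid walk)

classify : ∀ ks → All (λ c → c ≢ V₀ × c ≢ V₁) ks → SymbolicPolygon ks → ks ∈ normal-chains
classify [] _ (_ ∷ (() , _) ∷ [-])
classify (k ∷ ks) ((k≢V₀ , k≢V₁) ∷ avoid) polygon@(_ ∷ (d , supports) ∷ walk) =
  All.lookup candidates-classified k∷ks∈candidates polygon
  where
  start : Start k
  start = d , All.lookup supports (here refl) (λ ()) (λ e → k≢V₀ (sym e))
  k∷ks∈candidates : (k ∷ ks) ∈ candidates
  k∷ks∈candidates = ∈-concat⁺′
    (∈-map⁺ (k ∷_) (Chain⇒∈chains 4 (weight≤4 k)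
      (walk⇒Chain k ks (here refl) (there (here refl)) k≢V₀ k≢V₁ avoid walk)))
    (∈-map⁺ (λ k → map (k ∷_) (chains 4 k)) (∈-filter⁺ start? (∈-allS k) start))

-- The polygon in coordinates adapted to two consecutive vertices

det-from-heights : ∀ R .{{_ : ℤ.NonZero R}} v₀ v₁ x y a₀ a₁ b₀ b₁ → det v₁ v₀ ≡ R →
  det x v₀ ≡ R * a₀ → det x v₁ ≡ R * a₁ → det y v₀ ≡ R * b₀ → det y v₁ ≡ R * b₁ →
  det x y ≡ R * (a₁ * b₀ - a₀ * b₁)
det-from-heights R v₀ v₁ x y a₀ a₁ b₀ b₁ d₁₀ dx₀ dx₁ dy₀ dy₁ = ℤP.*-cancelˡ-≡ R _ _ (begin
  R * det x y
    ≡⟨ cong (_* det x y) d₁₀ ⟨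
  det v₁ v₀ * det x y
    ≡⟨ det-plücker v₁ v₀ x y ⟩
  det v₁ x * det v₀ y - det v₁ y * det v₀ x
    ≡⟨ cong₂ (λ p q → p * q - det v₁ y * det v₀ x) (det-antisym v₁ x) (det-antisym v₀ y) ⟩
  - det x v₁ * - det y v₀ - det v₁ y * det v₀ x
    ≡⟨ cong₂ (λ p q → - det x v₁ * - det y v₀ - p * q) (det-antisym v₁ y) (det-antisym v₀ x) ⟩
  - det x v₁ * - det y v₀ - - det y v₁ * - det x v₀
    ≡⟨ cong₂ (λ p q → - p * - q - - det y v₁ * - det x v₀) dx₁ dy₀ ⟩
  - (R * a₁) * - (R * b₀) - - det y v₁ * - det x v₀
    ≡⟨ cong₂ (λ p q → - (R * a₁) * - (R * b₀) - - p * - q) dy₁ dx₀ ⟩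
  - (R * a₁) * - (R * b₀) - - (R * b₁) * - (R * a₀)
    ≡⟨ factor R a₀ a₁ b₀ b₁ ⟩
  R * (R * (a₁ * b₀ - a₀ * b₁)) ∎)
  where
  open ≡-Reasoning
  factor : ∀ R a₀ a₁ b₀ b₁ → - (R * a₁) * - (R * b₀) - - (R * b₁) * - (R * a₀) ≡ R * (R * (a₁ * b₀ - a₀ * b₁))
  factor = solve-∀

scale : Tri → ℤ → ℤ
scale t⁻ z = - z
scale t⁰ z = 0ℤ
scale t⁺ z = z

shift : ℤ → Tri → ℤ
shift z t⁻ = z + 1ℤ
shift z t⁰ = z
shift z t⁺ = z - 1ℤ

opposite : Tri → Tri
opposite t⁻ = t⁺
opposite t⁰ = t⁰
opposite t⁺ = t⁻

*⟦⟧≡scale : ∀ z t → z * ⟦ t ⟧ ≡ scale t z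
*⟦⟧≡scale z t⁻ = *⟦t⁻⟧ z
*⟦⟧≡scale z t⁰ = ℤP.*-zeroʳ z
*⟦⟧≡scale z t⁺ = ℤP.*-identityʳ z

-⟦⟧*≡scale-opposite : ∀ z t → - (⟦ t ⟧ * z) ≡ scale (opposite t) z
-⟦⟧*≡scale-opposite z t⁻ = trans (cong -_ (ℤP.-1*i≡-i z)) (ℤP.neg-involutive z)
-⟦⟧*≡scale-opposite z t⁰ = refl
-⟦⟧*≡scale-opposite z t⁺ = cong -_ (ℤP.*-identityˡ z)

-⟦⟧≡shift : ∀ y t → y - ⟦ t ⟧ ≡ shift y t
-⟦⟧≡shift y t⁻ = refl
-⟦⟧≡shift y t⁰ = ℤP.+-identityʳ y
-⟦⟧≡shift y t⁺ = refl

-- In coordinates where v₀ = (0 , 1) and v₁ = (r , - s), the vertex with code (t₀ , t₁) is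
-- (t₀ r , - t₀ s - t₁); scale and shift spell it in the syntactic shape used by NormalForm.
vertex : ℤ → ℤ → S → Pt
vertex R s (t₀ , t₁) = (scale t₀ R , shift (scale (opposite t₀) s) t₁)

flip-y flip-x : Pt → Pt
flip-y (x , y) = (x , - y)
flip-x (x , y) = (- x , y)

pos₁ : ∀ {A : Set} {x a : A} {l} → x ∈ a ∷ x ∷ l
pos₁ = there (here refl)

pos₂ : ∀ {A : Set} {x a b : A} {l} → x ∈ a ∷ b ∷ x ∷ l
pos₂ = there pos₁

pos₃ : ∀ {A : Set} {x a b c : A} {l} → x ∈ a ∷ b ∷ c ∷ x ∷ l
pos₃ = there pos₂

module Polygon (r : ℕ) {{_ : ℕ.NonZero r}} (v₀ v₁ v₂ : Pt) (rest : List Pt)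
  (F : Fano (v₀ ∷ v₁ ∷ v₂ ∷ rest))
  (edge-det : All (λ e → det (proj₁ e) (proj₂ e) ≡ - + r) (edges (v₀ ∷ v₁ ∷ v₂ ∷ rest))) where

  open Fano F

  R : ℤ
  R = + r

  vs : List Pt
  vs = v₀ ∷ v₁ ∷ v₂ ∷ rest

  Edge : Pt → Pt → Set
  Edge a b = (a ∈ vs × b ∈ vs) × det a b ≡ - R ×
             (∀ p → p ∈ vs → p ≢ a → p ≢ b → det (b −ₚ a) (p −ₚ a) ℤ.< 0ℤ)

  boundary : Linked Edge (vs ∷ʳ v₀)
  boundary = zip-walk v₀ (v₁ ∷ v₂ ∷ rest) v₀ (All.zip (All-edges vs (All.tabulate id) , All.zip (edge-det , convex)))

  bézout : All Bézout vs
  bézout = All.map (Primitive⇒Bézout _) primVerts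

  v₀≢ : All (v₀ ≢_) (v₁ ∷ v₂ ∷ rest)
  v₀≢ = AllPairs.head distinct

  v₁≢ : All (v₁ ≢_) (v₂ ∷ rest)
  v₁≢ = AllPairs.head (AllPairs.tail distinct)

  reverse-edge-det : ∀ x y → Edge x y → det y x ≡ R
  reverse-edge-det x y xy = trans (det-antisym y x) (trans (cong -_ (proj₁ (proj₂ xy))) (ℤP.neg-involutive R))

  det-self≡R*0 : ∀ x → det x x ≡ R * 0ℤ
  det-self≡R*0 x = trans (det-self x) (sym (ℤP.*-zeroʳ R))

  det-v₁v₀ : det v₁ v₀ ≡ R
  det-v₁v₀ = reverse-edge-det v₀ v₁ (Linked.head boundary)

  module H₀ = Heights r Edge v₀ (λ e → proj₁ (proj₂ e)) (λ e → proj₂ (proj₂ e) v₀ (here refl))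
  module H₁ = Heights r Edge v₁ (λ e → proj₁ (proj₂ e)) (λ e → proj₂ (proj₂ e) v₁ pos₁)

  heights₀ : All H₀.Height vs
  heights₀ = (t⁰ , det-self≡R*0 v₀) ∷ proj₂ (H₀.heights v₀ v₁ (v₂ ∷ rest) 0ℤ 1ℤ
    boundary (All.tail bézout) v₀≢ (det-self≡R*0 v₀) (trans det-v₁v₀ (sym (ℤP.*-identityʳ R))) ℤP.≤-refl)

  heights₁ : All H₁.Height vs
  heights₁ = proj₂ split ∷ (t⁰ , det-self≡R*0 v₁) ∷ proj₁ split
    where
    later : All H₁.Height (v₂ ∷ rest ∷ʳ v₀)
    later = proj₂ (H₁.heights v₁ v₂ (rest ∷ʳ v₀) 0ℤ 1ℤ
      (Linked-∷ʳ v₁ (v₂ ∷ rest) (Linked.tail boundary) (Linked.head boundary))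
      (Allₚ.∷ʳ⁺ (All.tail (All.tail bézout)) (All.head bézout))
      (Allₚ.∷ʳ⁺ v₁≢ (λ e → All.head v₀≢ (sym e)))
      (det-self≡R*0 v₁)
      (trans (reverse-edge-det v₁ v₂ (Linked.head (Linked.tail boundary))) (sym (ℤP.*-identityʳ R)))
      ℤP.≤-refl)
    split : All H₁.Height (v₂ ∷ rest) × H₁.Height v₀
    split = Allₚ.∷ʳ⁻ {xs = v₂ ∷ rest} later

  R*⟦⟧-injective : ∀ {t u} → R * ⟦ t ⟧ ≡ R * ⟦ u ⟧ → t ≡ u
  R*⟦⟧-injective e = ⟦⟧-injective (ℤP.*-cancelˡ-≡ R _ _ e)

  -- t⁻ is a junk value outside {- R , 0 , R}.
  level : ℤ → Tri
  level d with d ℤ.≟ R * ⟦ t⁺ ⟧ | d ℤ.≟ R * ⟦ t⁰ ⟧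
  ... | yes _ | _     = t⁺
  ... | no _  | yes _ = t⁰
  ... | no _  | no _  = t⁻

  level-R*⟦⟧ : ∀ t → level (R * ⟦ t ⟧) ≡ t
  level-R*⟦⟧ t with R * ⟦ t ⟧ ℤ.≟ R * ⟦ t⁺ ⟧ | R * ⟦ t ⟧ ℤ.≟ R * ⟦ t⁰ ⟧
  level-R*⟦⟧ t  | yes e | _     = sym (R*⟦⟧-injective e)
  level-R*⟦⟧ t  | no _  | yes e = sym (R*⟦⟧-injective e)
  level-R*⟦⟧ t⁻ | no _  | no _  = refl
  level-R*⟦⟧ t⁰ | no _  | no ≢⁰ = contradiction refl ≢⁰
  level-R*⟦⟧ t⁺ | no ≢⁺ | no _  = contradiction refl ≢⁺

  level-height : ∀ {d t} → d ≡ R * ⟦ t ⟧ → d ≡ R * ⟦ level d ⟧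
  level-height {d} {t} d≡ = trans d≡ (cong (λ u → R * ⟦ u ⟧) (sym (trans (cong level d≡) (level-R*⟦⟧ t))))

  σ : Pt → S
  σ x = (level (det x v₀) , level (det x v₁))

  σ-heights : All (λ x → det x v₀ ≡ R * ⟦ proj₁ (σ x) ⟧ × det x v₁ ≡ R * ⟦ proj₂ (σ x) ⟧) vs
  σ-heights = All.zipWith (λ ((_ , d₀) , (_ , d₁)) → level-height d₀ , level-height d₁) (heights₀ , heights₁)

  σv₀ : σ v₀ ≡ V₀
  σv₀ = cong₂ _,_ (trans (cong level (det-self≡R*0 v₀)) (level-R*⟦⟧ t⁰))
                  (trans (cong level (trans (proj₁ (proj₂ (Linked.head boundary))) (sym (*⟦t⁻⟧ R)))) (level-R*⟦⟧ t⁻))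

  σv₁ : σ v₁ ≡ V₁
  σv₁ = cong₂ _,_ (trans (cong level (trans det-v₁v₀ (sym (ℤP.*-identityʳ R)))) (level-R*⟦⟧ t⁺))
                  (trans (cong level (det-self≡R*0 v₁)) (level-R*⟦⟧ t⁰))

  det-σ : ∀ {x y} → x ∈ vs → y ∈ vs → det x y ≡ R * dS (σ x) (σ y)
  det-σ {x} {y} x∈ y∈ = det-from-heights R v₀ v₁ x y _ _ _ _ det-v₁v₀
    (proj₁ (All.lookup σ-heights x∈)) (proj₂ (All.lookup σ-heights x∈))
    (proj₁ (All.lookup σ-heights y∈)) (proj₂ (All.lookup σ-heights y∈))

  det-−ₚ-σ : ∀ {a b p} → a ∈ vs → b ∈ vs → p ∈ vs → det (b −ₚ a) (p −ₚ a) ≡ R * convS (σ a) (σ b) (σ p)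
  det-−ₚ-σ {a} {b} {p} a∈ b∈ p∈ = begin
    det (b −ₚ a) (p −ₚ a)
      ≡⟨ det-−ₚ a b p ⟩
    det b p - det b a - det a p
      ≡⟨ cong₂ (λ x y → x - y - det a p) (det-σ b∈ p∈) (det-σ b∈ a∈) ⟩
    R * dS (σ b) (σ p) - R * dS (σ b) (σ a) - det a p
      ≡⟨ cong (λ z → R * dS (σ b) (σ p) - R * dS (σ b) (σ a) - z) (det-σ a∈ p∈) ⟩
    R * dS (σ b) (σ p) - R * dS (σ b) (σ a) - R * dS (σ a) (σ p)
      ≡⟨ factor R _ _ _ ⟩
    R * convS (σ a) (σ b) (σ p) ∎
    where
    open ≡-Reasoning
    factor : ∀ R x y z → R * x - R * y - R * z ≡ R * (x - y - z)
    factor = solve-∀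

  m n : ℤ
  m = proj₁ (All.head bézout)
  n = proj₁ (proj₂ (All.head bézout))

  m*a+n*b≡1 : m * proj₁ v₀ + n * proj₂ v₀ ≡ 1ℤ
  m*a+n*b≡1 = proj₂ (proj₂ (All.head bézout))

  detGL-A₀ : proj₂ v₀ * n - - proj₁ v₀ * m ≡ 1ℤ
  detGL-A₀ = trans (regroup (proj₁ v₀) (proj₂ v₀) m n) m*a+n*b≡1
    where
    regroup : ∀ a b m n → b * n - - a * m ≡ m * a + n * b
    regroup = solve-∀

  A₀ : GL2
  A₀ = record { a₁₁ = proj₂ v₀ ; a₁₂ = - proj₁ v₀ ; a₂₁ = m ; a₂₂ = n ; unimodular = inj₁ detGL-A₀ }

  A₁ : GL2
  A₁ = record { a₁₁ = proj₂ v₀ ; a₁₂ = - proj₁ v₀ ; a₂₁ = - m ; a₂₂ = - n ; unimodular = inj₂ det≡-1 }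
    where
    regroup : ∀ a b m n → b * - n - - a * - m ≡ - (m * a + n * b)
    regroup = solve-∀
    det≡-1 : proj₂ v₀ * - n - - proj₁ v₀ * - m ≡ -1ℤ
    det≡-1 = trans (regroup (proj₁ v₀) (proj₂ v₀) m n) (cong -_ m*a+n*b≡1)

  A₂ : GL2
  A₂ = record { a₁₁ = - proj₂ v₀ ; a₁₂ = proj₁ v₀ ; a₂₁ = m ; a₂₂ = n ; unimodular = inj₂ det≡-1 }
    where
    regroup : ∀ a b m n → - b * n - a * m ≡ - (m * a + n * b)
    regroup = solve-∀
    det≡-1 : - proj₂ v₀ * n - proj₁ v₀ * m ≡ -1ℤ
    det≡-1 = trans (regroup (proj₁ v₀) (proj₂ v₀) m n) (cong -_ m*a+n*b≡1)

  s : ℤ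
  s = - proj₂ (act A₀ v₁)

  act-A₀-first : ∀ x → proj₁ (act A₀ x) ≡ det x v₀
  act-A₀-first (x , y) = in-coordinates (proj₁ v₀) (proj₂ v₀) x y
    where
    in-coordinates : ∀ a b x y → b * x + - a * y ≡ x * b - y * a
    in-coordinates = solve-∀

  act-A₀-v₁ : act A₀ v₁ ≡ (R , - s)
  act-A₀-v₁ = cong₂ _,_ (trans (act-A₀-first v₁) det-v₁v₀) (sym (ℤP.neg-involutive _))

  second-coordinate : ∀ X Y t₀ t₁ → X ≡ R * t₀ → X * (- s) - Y * R ≡ R * t₁ → Y ≡ - (t₀ * s) - t₁
  second-coordinate .(R * t₀) Y t₀ t₁ refl e = ℤP.*-cancelˡ-≡ R _ _ (begin
    R * Y                                 ≡⟨ isolate R Y t₀ s ⟩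
    R * t₀ * - s - (R * t₀ * - s - Y * R) ≡⟨ cong (λ z → R * t₀ * - s - z) e ⟩
    R * t₀ * - s - R * t₁                 ≡⟨ factor R t₀ t₁ s ⟩
    R * (- (t₀ * s) - t₁)                 ∎)
    where
    open ≡-Reasoning
    isolate : ∀ R Y t₀ s → R * Y ≡ R * t₀ * - s - (R * t₀ * - s - Y * R)
    isolate = solve-∀
    factor : ∀ R t₀ t₁ s → R * t₀ * - s - R * t₁ ≡ R * (- (t₀ * s) - t₁)
    factor = solve-∀

  act-A₀ : ∀ {x} → x ∈ vs → act A₀ x ≡ vertex R s (σ x)
  act-A₀ {x} x∈ = cong₂ _,_ (trans X≡ (*⟦⟧≡scale R t₀))
    (trans (second-coordinate _ _ ⟦ t₀ ⟧ ⟦ t₁ ⟧ X≡ det≡)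
           (trans (cong (_- ⟦ t₁ ⟧) (-⟦⟧*≡scale-opposite s t₀)) (-⟦⟧≡shift _ t₁)))
    where
    open ≡-Reasoning
    t₀ t₁ : Tri
    t₀ = proj₁ (σ x)
    t₁ = proj₂ (σ x)
    X≡ : proj₁ (act A₀ x) ≡ R * ⟦ t₀ ⟧
    X≡ = trans (act-A₀-first x) (proj₁ (All.lookup σ-heights x∈))
    det≡ : det (act A₀ x) (R , - s) ≡ R * ⟦ t₁ ⟧
    det≡ = begin
      det (act A₀ x) (R , - s)     ≡⟨ cong (det (act A₀ x)) act-A₀-v₁ ⟨
      det (act A₀ x) (act A₀ v₁)   ≡⟨ det-act A₀ x v₁ ⟩
      detGL A₀ * det x v₁          ≡⟨ cong (_* det x v₁) detGL-A₀ ⟩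
      1ℤ * det x v₁                ≡⟨ ℤP.*-identityˡ (det x v₁) ⟩
      det x v₁                     ≡⟨ proj₂ (All.lookup σ-heights x∈) ⟩
      R * ⟦ t₁ ⟧                   ∎

  act-A₁ : ∀ {x} → x ∈ vs → act A₁ x ≡ flip-y (vertex R s (σ x))
  act-A₁ {x₁ , x₂} x∈ = trans (cong (proj₁ (act A₀ (x₁ , x₂)) ,_) (in-coordinates m n x₁ x₂))
                              (cong flip-y (act-A₀ x∈))
    where
    in-coordinates : ∀ m n x₁ x₂ → - m * x₁ + - n * x₂ ≡ - (m * x₁ + n * x₂)
    in-coordinates = solve-∀

  act-A₂ : ∀ {x} → x ∈ vs → act A₂ x ≡ flip-x (vertex R s (σ x))
  act-A₂ {x₁ , x₂} x∈ = trans (cong (_, proj₂ (act A₀ (x₁ , x₂))) (in-coordinates (proj₁ v₀) (proj₂ v₀) x₁ x₂))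
                              (cong flip-x (act-A₀ x∈))
    where
    in-coordinates : ∀ a b x₁ x₂ → - b * x₁ + a * x₂ ≡ - (b * x₁ + - a * x₂)
    in-coordinates = solve-∀

  σ-injective : ∀ {x y} → x ∈ vs → y ∈ vs → σ x ≡ σ y → x ≡ y
  σ-injective x∈ y∈ e = act-injective A₀ (trans (act-A₀ x∈) (trans (cong (vertex R s) e) (sym (act-A₀ y∈))))

  σ-edge : ∀ {a b} → Edge a b → SymEdge (map σ vs) (σ a) (σ b)
  σ-edge {a} {b} ((a∈ , b∈) , d , supports) =
    ℤP.*-cancelˡ-≡ R _ _ (trans (sym (det-σ a∈ b∈)) (trans d (sym (*⟦t⁻⟧ R)))) ,
    Allₚ.map⁺ (All.tabulate λ {p} p∈ σp≢σa σp≢σb → +n*i<0⇒i<0 r _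
      (subst (ℤ._< 0ℤ) (det-−ₚ-σ a∈ b∈ p∈)
        (supports p p∈ (λ e → σp≢σa (cong σ e)) (λ e → σp≢σb (cong σ e)))))

  σ-polygon : SymbolicPolygon (map σ (v₂ ∷ rest))
  σ-polygon = subst₂ (λ A B → Linked (SymEdge (A ∷ B ∷ map σ (v₂ ∷ rest))) (A ∷ B ∷ map σ (v₂ ∷ rest) ∷ʳ A))
    σv₀ σv₁
    (subst (Linked (SymEdge (map σ vs))) (Listₚ.map-++ σ vs [ v₀ ]) (Linkedₚ.map⁺ (Linked.map σ-edge boundary)))

  σ-avoids : All (λ c → c ≢ V₀ × c ≢ V₁) (map σ (v₂ ∷ rest))
  σ-avoids = Allₚ.map⁺ (All.tabulate λ {x} x∈ →
    (λ e → All.lookup v₀≢ (there x∈) (sym (σ-injective (there (there x∈)) (here refl) (trans e (sym σv₀))))) ,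
    (λ e → All.lookup v₁≢ x∈ (sym (σ-injective (there (there x∈)) pos₁ (trans e (sym σv₁))))))

  σ-normal : map σ (v₂ ∷ rest) ∈ normal-chains
  σ-normal = classify _ σ-avoids σ-polygon

  InNormalForm : Set
  InNormalForm = Σ GL2 λ A → Σ ℤ λ s′ → NormalForm r s′ (map (act A) vs)

  same-vertices : ∀ (A : GL2) (f : S → Pt) → (∀ {x} → x ∈ vs → act A x ≡ f (σ x)) →
    ∀ {ks} → map σ (v₂ ∷ rest) ≡ ks → ∀ K′ {N} →
    True ((V₀ ∷ V₁ ∷ ks) ⊆? K′) → True (K′ ⊆? (V₀ ∷ V₁ ∷ ks)) → map f K′ ≡ N → SameSet (map (act A) vs) N
  same-vertices A f act≡ {ks} e K′ ⊆K′ K′⊆ refl =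
    (λ y y∈ → Subsetₚ.map⁺ f (toWitness ⊆K′) (subst (y ∈_) images y∈)) ,
    (λ y y∈ → subst (y ∈_) (sym images) (Subsetₚ.map⁺ f (toWitness K′⊆) y∈))
    where
    images : map (act A) vs ≡ map f (V₀ ∷ V₁ ∷ ks)
    images = begin
      map (act A) vs          ≡⟨ Listₚ.map-cong-local (All.tabulate act≡) ⟩
      map (f ∘ σ) vs          ≡⟨ Listₚ.map-∘ vs ⟩
      map f (map σ vs)        ≡⟨ cong (map f) (cong₂ _∷_ σv₀ (cong₂ _∷_ σv₁ e)) ⟩
      map f (V₀ ∷ V₁ ∷ ks)    ∎
      where open ≡-Reasoning

  primitive-vertices : ∀ A {N} → SameSet (map (act A) vs) N → ∀ {y} → y ∈ N → Primitive y
  primitive-vertices A same {y} y∈ with ∈-map⁻ (act A) (proj₂ same y y∈)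
  ... | x , x∈ , refl = Bézout⇒Primitive (act A x) (act-Bézout A x (All.lookup bézout x∈))

  Coordinates : Set
  Coordinates = Σ GL2 λ A → Σ (S → Pt) λ f → ∀ {x} → x ∈ vs → act A x ≡ f (σ x)

  coordinates₀ coordinates₁ coordinates₂ : Coordinates
  coordinates₀ = A₀ , vertex R s , act-A₀
  coordinates₁ = A₁ , flip-y ∘ vertex R s , act-A₁
  coordinates₂ = A₂ , flip-x ∘ vertex R s , act-A₂

  normal-form-via : ((A , f , _) : Coordinates) → ∀ K′ s′ {N} → map f K′ ≡ N →
    ((∀ {y} → y ∈ N → Primitive y) → SameSet (map (act A) vs) N → NormalForm r s′ (map (act A) vs)) →
    ∀ {ks} → True ((V₀ ∷ V₁ ∷ ks) ⊆? K′) → True (K′ ⊆? (V₀ ∷ V₁ ∷ ks)) →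
    map σ (v₂ ∷ rest) ≡ ks → InNormalForm
  normal-form-via (A , f , act≡) K′ s′ {N} fK′≡N normal-form ⊆K′ K′⊆ e =
    A , s′ , normal-form (primitive-vertices A same) same
    where
    same : SameSet (map (act A) vs) N
    same = same-vertices A f act≡ e K′ ⊆K′ K′⊆ fK′≡N

  left-Cop : ∀ t → Primitive (- R , t) → Cop r t
  left-Cop t = subst (λ g → gcd g ∣ t ∣ ≡ 1) (ℤP.∣-i∣≡∣i∣ R)

  right-Cop : ∀ t → Primitive (R , - t) → Cop r t
  right-Cop t = subst (λ g → gcd r g ≡ 1) (ℤP.∣-i∣≡∣i∣ t)

  right-Cop+1 : Primitive (R , - s - 1ℤ) → Cop r (s + 1ℤ)
  right-Cop+1 = right-Cop (s + 1ℤ) ∘ subst (λ y → Primitive (R , y)) (sym (ℤP.neg-distrib-+ s 1ℤ))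

  normal-forms : All (λ ks → map σ (v₂ ∷ rest) ≡ ks → InNormalForm) normal-chains
  normal-forms =
    normal-form-via coordinates₀ (V₀ ∷ (t⁻ , t⁺) ∷ V₁ ∷ []) s refl
      (λ prim → nf1 (right-Cop s (prim pos₂)) (left-Cop (s - 1ℤ) (prim pos₁))) _ _ ∷
    normal-form-via coordinates₀ (V₀ ∷ (t⁻ , t⁰) ∷ (t⁻ , t⁺) ∷ V₁ ∷ []) s refl
      (λ prim → nf5 (left-Cop s (prim pos₁)) (left-Cop (s - 1ℤ) (prim pos₂))) _ _ ∷
    normal-form-via coordinates₀ (V₀ ∷ (t⁻ , t⁻) ∷ (t⁰ , t⁺) ∷ V₁ ∷ []) s refl
      (λ prim → nf3 (right-Cop s (prim pos₃)) (left-Cop (s + 1ℤ) (prim pos₁))) _ _ ∷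
    normal-form-via coordinates₀ (V₀ ∷ (t⁻ , t⁰) ∷ (t⁰ , t⁺) ∷ V₁ ∷ []) s refl
      (λ prim → nf2 (left-Cop s (prim pos₁))) _ _ ∷
    normal-form-via coordinates₀ (V₀ ∷ (t⁻ , t⁻) ∷ (t⁻ , t⁰) ∷ (t⁰ , t⁺) ∷ V₁ ∷ []) s refl
      (λ prim → nf6 (left-Cop s (prim pos₂)) (left-Cop (s + 1ℤ) (prim pos₁))) _ _ ∷
    normal-form-via coordinates₁ ((t⁰ , t⁺) ∷ (t⁻ , t⁺) ∷ V₀ ∷ V₁ ∷ []) (- s)
      (cong (λ y → (0ℤ , 1ℤ) ∷ (- R , y) ∷ (0ℤ , -1ℤ) ∷ (R , - - s) ∷ []) (ℤP.neg-distrib-+ s -1ℤ))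
      (λ prim → nf3 (right-Cop (- s) (prim pos₃)) (left-Cop (- s + 1ℤ) (prim pos₁))) _ _ ∷
    normal-form-via coordinates₀ (V₀ ∷ (t⁻ , t⁰) ∷ (t⁻ , t⁺) ∷ (t⁰ , t⁺) ∷ V₁ ∷ []) s refl
      (λ prim → nf7 (left-Cop s (prim pos₁)) (left-Cop (s - 1ℤ) (prim pos₂))) _ _ ∷
    normal-form-via coordinates₀ (V₀ ∷ (t⁻ , t⁰) ∷ (t⁺ , t⁺) ∷ V₁ ∷ []) s refl
      (λ prim → nf4 (left-Cop s (prim pos₁)) (right-Cop+1 (prim pos₂))) _ _ ∷
    normal-form-via coordinates₀ (V₀ ∷ (t⁻ , t⁻) ∷ (t⁻ , t⁰) ∷ (t⁺ , t⁺) ∷ V₁ ∷ []) s refl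
      (λ prim → nf8 (left-Cop s (prim pos₂)) (left-Cop (s + 1ℤ) (prim pos₁))) _ _ ∷
    normal-form-via coordinates₂ (V₀ ∷ V₁ ∷ (t⁺ , t⁺) ∷ (t⁰ , t⁺) ∷ (t⁻ , t⁻) ∷ []) (- s - 1ℤ)
      (cong₂ (λ y z → (0ℤ , 1ℤ) ∷ (- R , y) ∷ (- R , - s - 1ℤ) ∷ (0ℤ , -1ℤ) ∷ z ∷ [])
             (add-and-subtract-1 s) (cong₂ _,_ (ℤP.neg-involutive R) (negate-minus-1 s)))
      (λ prim → nf6 (left-Cop (- s - 1ℤ) (prim pos₂)) (left-Cop (- s - 1ℤ + 1ℤ) (prim pos₁))) _ _ ∷
    normal-form-via coordinates₂ (V₀ ∷ V₁ ∷ (t⁺ , t⁺) ∷ (t⁰ , t⁺) ∷ (t⁻ , t⁰) ∷ []) (- s)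
      (cong₂ (λ x z → (0ℤ , 1ℤ) ∷ (- R , - s) ∷ (- R , - s - 1ℤ) ∷ (0ℤ , -1ℤ) ∷ (x , z) ∷ [])
             (ℤP.neg-involutive R) (sym (ℤP.neg-involutive s)))
      (λ prim → nf7 (left-Cop (- s) (prim pos₁)) (left-Cop (- s - 1ℤ) (prim pos₂))) _ _ ∷
    normal-form-via coordinates₀ (V₀ ∷ (t⁻ , t⁻) ∷ (t⁻ , t⁰) ∷ (t⁰ , t⁺) ∷ (t⁺ , t⁺) ∷ V₁ ∷ []) s refl
      (λ prim → nf9 (left-Cop s (prim pos₂)) (left-Cop (s + 1ℤ) (prim pos₁))) _ _ ∷
    []
    where
    add-and-subtract-1 : ∀ s → - s ≡ - s - 1ℤ + 1ℤ
    add-and-subtract-1 = solve-∀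
    negate-minus-1 : ∀ s → s + 1ℤ ≡ - (- s - 1ℤ)
    negate-minus-1 = solve-∀

  normal-lengths : All (λ ks → 1 ≤ length ks × length ks ≤ 4) normal-chains
  normal-lengths = toWitness {a? = all? (λ ks → 1 ℕ.≤? length ks ×-dec length ks ℕ.≤? 4) normal-chains} _

  vertex-count : 3 ≤ length vs × length vs ≤ 6
  vertex-count = subst (λ k → 3 ≤ suc (suc k) × suc (suc k) ≤ 6) (Listₚ.length-map σ (v₂ ∷ rest))
    (Product.map (λ 1≤k → s≤s (s≤s 1≤k)) (λ k≤4 → s≤s (s≤s k≤4)) (All.lookup normal-lengths σ-normal))

  normal-form : InNormalForm
  normal-form = All.lookup normal-forms σ-normal refl

theorem1p6 : (r : ℕ) → 0 < r → r ≢ 1 → r ≢ 2 → r ≢ 4 →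
    (vs : List Pt) → Fano vs →
    proj₁ (SC vs) ≡ 0 →
    All (λ C → Σ ℕ λ s → 1 ≤ s × s < r × gcd r s ≡ 1 × Represents C r s) (proj₂ (SC vs)) →
    (3 ≤ length (proj₂ (SC vs)) × length (proj₂ (SC vs)) ≤ 6) ×
    (Σ GL2 λ A → Σ ℤ λ s → NormalForm r s (map (act A) vs))
theorem1p6 r 0<r _ _ _ []                 F = contradiction (Fano.atLeast3 F) λ ()
theorem1p6 r 0<r _ _ _ (_ ∷ [])           F = contradiction (Fano.atLeast3 F) λ { (s≤s ()) }
theorem1p6 r 0<r _ _ _ (_ ∷ _ ∷ [])       F = contradiction (Fano.atLeast3 F) λ { (s≤s (s≤s ())) }
theorem1p6 r 0<r _ _ _ vs@(v₀ ∷ v₁ ∷ v₂ ∷ rest) F no-T reps =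
  subst (λ k → 3 ≤ k × k ≤ 6) (sym basket-length) vertex-count , normal-form
  where
  open Polygon r {{ℕ.>-nonZero 0<r}} v₀ v₁ v₂ rest F (edge-det≡-r r vs F no-T reps) using (vertex-count; normal-form)
  basket-length : length (proj₂ (SC vs)) ≡ length vs
  basket-length = trans (cong length (basket-without-T-cones vs F no-T))
    (trans (Listₚ.length-map scaled (edges vs)) (length-zip-walk v₀ (v₁ ∷ v₂ ∷ rest) v₀))
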